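{- Let $b_2=b_3=12$, $b_4=b_5=60$, $b_6=b_7=84$, $b_8=b_9=60$, $b_{10}=b_{11}=132$, $b_{12}=b_{13}=5460$, $b_{14}=b_{15}=12$. Then for every $r\in\{2,3,\dots,15\}$ and every positive integer $n$, $$b_r\sum_{k=0}^{n-1}kS_k^{(r)}\equiv 0\pmod{n^2},$$ where $S_m^{(s)}=\sum_{k=0}^{m}\binom{m}{k}^2\binom{2k}{k}(2k+1)^{s}$. -}

module Defs where

open import Data.Nat using (ℕ; zero; suc; _+_; _*_; _^_)
open import Data.Nat.Combinatorics using (_C_)

sumBelow : ℕ → (ℕ → ℕ) → ℕ
sumBelow zero    f = 0
sumBelow (suc n) f = sumBelow n f + f n

S : ℕ → ℕ → ℕ
S s m = sumBelow (suc m) (λ k → (m C k) ^ 2 * ((2 * k) C k) * (2 * k + 1) ^ s)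

-- the constants b_r for 2 ≤ r ≤ 15 (value 0 outside this range; never used there)
b : ℕ → ℕ
b 2  = 12
b 3  = 12
b 4  = 60
b 5  = 60
b 6  = 84
b 7  = 84
b 8  = 60
b 9  = 60
b 10 = 132
b 11 = 132
b 12 = 5460
b 13 = 5460
b 14 = 12
b 15 = 12
b _  = 0

{-# OPTIONS --safe #-}
-- Write r = s + 1 and c = b_r / 2, and let B be the polynomial with
-- (j + 1) B(j + 1) = j B(j) + c (1 − j) (2j + 1)^s; the constants b_r are such that B is
-- integer-valued, which is checked from its Newton coefficients. With the Catalan number Cat_j, put
-- α_j = Cat_j (2j + 1) (c (2j + 1)^s − B(j + 1)) and β_j = C(2j, j) B(j), and
-- G(n) = Σ_j P_j (P_j α_j + Q_j β_j) where P_j = (n − j) C(n, j) and Q_j = j C(n, j).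
-- Term by term, G(n + 1) − G(n) is C(n, j)² ((j + 1)(2n + 1 − j) α_j + j (2j + 1) β_j
-- + (j + 1)(n − j) β_{j+1}) up to a telescoping sum, and the recurrence turns the bracket into
-- 2cn C(2j, j) (2j + 1)^r. Hence G(n) = b_r Σ_{k<n} k S_k^{(r)}. On the other hand
-- (n − j) C(n, j) = n C(n − 1, j) and j C(n, j) = n C(n − 1, j − 1), so n² divides every term of G(n).
module Submission where

open import Data.Nat using (ℕ; zero; suc)
import Data.Nat as ℕ
open import Data.Nat.Combinatorics using (_C_)
open import Data.Integer using (ℤ)
open import Data.List using (List; []; _∷_; map; drop)
open import Data.List.Relation.Unary.All using (All; []; _∷_)
open import Relation.Binary.PropositionalEquality
open ≡-Reasoning

open import Defs

module Nat where
  open import Data.Nat using (_+_; _*_)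
  open import Data.Nat.Combinatorics using (nCk+nC[k+1]≡[n+1]C[k+1]; nC1≡n)
  open import Data.Nat.Properties using (*-zeroʳ; *-comm; +-comm; +-identityʳ; *-distribˡ-+)
  open import Data.Nat.Tactic.RingSolver using (solve-∀)

  [k+1]*[n+1]C[k+1]≡[n+1]*nCk : ∀ n k → suc k * (suc n C suc k) ≡ suc n * (n C k)
  [k+1]*[n+1]C[k+1]≡[n+1]*nCk zero    zero    = refl
  [k+1]*[n+1]C[k+1]≡[n+1]*nCk zero    (suc k) = *-zeroʳ (suc (suc k))
  [k+1]*[n+1]C[k+1]≡[n+1]*nCk (suc n) zero    = begin
    1 * (suc (suc n) C 1)  ≡⟨ cong (1 *_) (nC1≡n (suc (suc n))) ⟩
    1 * suc (suc n)        ≡⟨ *-comm 1 (suc (suc n)) ⟩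
    suc (suc n) * 1        ∎
  [k+1]*[n+1]C[k+1]≡[n+1]*nCk (suc n) (suc k) = begin
    suc (suc k) * (suc (suc n) C suc (suc k))
      ≡⟨ cong (suc (suc k) *_) (sym (nCk+nC[k+1]≡[n+1]C[k+1] (suc n) (suc k))) ⟩
    suc (suc k) * (x + y)
      ≡⟨ distribute x y k ⟩
    x + (suc k * x + suc (suc k) * y)
      ≡⟨ cong₂ (λ u v → x + (u + v)) ([k+1]*[n+1]C[k+1]≡[n+1]*nCk n k)
                                      ([k+1]*[n+1]C[k+1]≡[n+1]*nCk n (suc k)) ⟩
    x + (suc n * (n C k) + suc n * (n C suc k))
      ≡⟨ cong (_+ (suc n * (n C k) + suc n * (n C suc k))) (sym (nCk+nC[k+1]≡[n+1]C[k+1] n k)) ⟩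
    (n C k + n C suc k) + (suc n * (n C k) + suc n * (n C suc k))
      ≡⟨ collect (n C k) (n C suc k) n ⟩
    suc (suc n) * (n C k + n C suc k)
      ≡⟨ cong (suc (suc n) *_) (nCk+nC[k+1]≡[n+1]C[k+1] n k) ⟩
    suc (suc n) * (suc n C suc k) ∎
    where
    x = suc n C suc k
    y = suc n C suc (suc k)
    distribute : ∀ x y k → suc (suc k) * (x + y) ≡ x + (suc k * x + suc (suc k) * y)
    distribute = solve-∀
    collect : ∀ x y n → (x + y) + (suc n * x + suc n * y) ≡ suc (suc n) * (x + y)
    collect = solve-∀

  [k+1]*nC[k+1]+k*nCk≡n*nCk : ∀ n k → suc k * (n C suc k) + k * (n C k) ≡ n * (n C k)
  [k+1]*nC[k+1]+k*nCk≡n*nCk zero    zero    = refl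
  [k+1]*nC[k+1]+k*nCk≡n*nCk zero    (suc k) = cong₂ _+_ (*-zeroʳ (suc (suc k))) (*-zeroʳ (suc k))
  [k+1]*nC[k+1]+k*nCk≡n*nCk (suc n) zero    = begin
    1 * (suc n C 1) + 0  ≡⟨ cong (λ m → 1 * m + 0) (nC1≡n (suc n)) ⟩
    1 * suc n + 0        ≡⟨ +-identityʳ (1 * suc n) ⟩
    1 * suc n            ≡⟨ *-comm 1 (suc n) ⟩
    suc n * 1            ∎
  [k+1]*nC[k+1]+k*nCk≡n*nCk (suc n) (suc k) = begin
    suc (suc k) * (suc n C suc (suc k)) + suc k * (suc n C suc k)
      ≡⟨ cong₂ _+_ ([k+1]*[n+1]C[k+1]≡[n+1]*nCk n (suc k)) ([k+1]*[n+1]C[k+1]≡[n+1]*nCk n k) ⟩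
    suc n * (n C suc k) + suc n * (n C k)
      ≡⟨ +-comm (suc n * (n C suc k)) _ ⟩
    suc n * (n C k) + suc n * (n C suc k)
      ≡⟨ sym (*-distribˡ-+ (suc n) (n C k) (n C suc k)) ⟩
    suc n * (n C k + n C suc k)
      ≡⟨ cong (suc n *_) (nCk+nC[k+1]≡[n+1]C[k+1] n k) ⟩
    suc n * (suc n C suc k) ∎

module Binomial where
  open import Data.Integer using (+_; _+_; _-_; _*_; 0ℤ; 1ℤ)
  open import Data.Integer.Properties using (pos-+; pos-*)
  open import Data.Integer.Tactic.RingSolver using (solve-∀)
  import Data.Nat.Combinatorics as ℕC
  open import Data.Nat.Properties using (+-suc; n<1+n)

  binom : ℕ → ℕ → ℤ
  binom n k = + (n C k)

  nC[n+1]≡0 : ∀ n → binom n (suc n) ≡ 0ℤ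
  nC[n+1]≡0 n = cong +_ (ℕC.k>n⇒nCk≡0 (n<1+n n))

  nCk+nC[k+1]≡[n+1]C[k+1] : ∀ n k → binom n k + binom n (suc k) ≡ binom (suc n) (suc k)
  nCk+nC[k+1]≡[n+1]C[k+1] n k = trans (sym (pos-+ (n C k) _)) (cong +_ (ℕC.nCk+nC[k+1]≡[n+1]C[k+1] n k))

  [k+1]*[n+1]C[k+1]≡[n+1]*nCk : ∀ n k → + suc k * binom (suc n) (suc k) ≡ + suc n * binom n k
  [k+1]*[n+1]C[k+1]≡[n+1]*nCk n k = begin
    + suc k * binom (suc n) (suc k)  ≡⟨ pos-* (suc k) _ ⟨
    + (suc k ℕ.* (suc n C suc k))    ≡⟨ cong +_ (Nat.[k+1]*[n+1]C[k+1]≡[n+1]*nCk n k) ⟩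
    + (suc n ℕ.* (n C k))            ≡⟨ pos-* (suc n) _ ⟩
    + suc n * binom n k              ∎

  [k+1]*nC[k+1]≡[n-k]*nCk : ∀ n k → + suc k * binom n (suc k) ≡ (+ n - + k) * binom n k
  [k+1]*nC[k+1]≡[n-k]*nCk n k = begin
    + suc k * x₁                          ≡⟨ add-sub (+ suc k * x₁) (+ k * x₀) ⟩
    (+ suc k * x₁ + + k * x₀) - + k * x₀  ≡⟨ cong (_- + k * x₀) absorption ⟩
    + n * x₀ - + k * x₀                   ≡⟨ factor-sub (+ n) (+ k) x₀ ⟨
    (+ n - + k) * x₀                      ∎
    where
    add-sub : ∀ a b → a ≡ (a + b) - b
    add-sub = solve-∀
    factor-sub : ∀ a b c → (a - b) * c ≡ a * c - b * c
    factor-sub = solve-∀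
    x₀ = binom n k
    x₁ = binom n (suc k)
    absorption : + suc k * x₁ + + k * x₀ ≡ + n * x₀
    absorption = begin
      + suc k * x₁ + + k * x₀                   ≡⟨ cong₂ _+_ (pos-* (suc k) _) (pos-* k _) ⟨
      + (suc k ℕ.* (n C suc k) ℕ.+ k ℕ.* (n C k)) ≡⟨ cong +_ (Nat.[k+1]*nC[k+1]+k*nCk≡n*nCk n k) ⟩
      + (n ℕ.* (n C k))                         ≡⟨ pos-* n _ ⟩
      + n * x₀                                  ∎

  -- + suc n is definitionally 1ℤ + + n, so ring identities are stated with 1ℤ + n to apply to successors.
  [n+1-k]*[n+1]Ck≡[n+1]*nCk : ∀ n k → (+ suc n - + k) * binom (suc n) k ≡ + suc n * binom n k
  [n+1-k]*[n+1]Ck≡[n+1]*nCk n zero    = sub-zero (+ suc n) (+ 1)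
    where
    sub-zero : ∀ a b → (a - + 0) * b ≡ a * b
    sub-zero = solve-∀
  [n+1-k]*[n+1]Ck≡[n+1]*nCk n (suc k) = begin
    (+ suc n - + suc k) * binom (suc n) (suc k)
      ≡⟨ cong ((+ suc n - + suc k) *_) (nCk+nC[k+1]≡[n+1]C[k+1] n k) ⟨
    (+ suc n - + suc k) * (x₀ + x₁)
      ≡⟨ split (+ n) (+ k) x₀ x₁ ⟩
    (+ n - + k) * x₀ + (+ suc n - + suc k) * x₁
      ≡⟨ cong (_+ (+ suc n - + suc k) * x₁) ([k+1]*nC[k+1]≡[n-k]*nCk n k) ⟨
    + suc k * x₁ + (+ suc n - + suc k) * x₁
      ≡⟨ collect (+ n) (+ k) x₁ ⟩
    + suc n * x₁ ∎
    where
    x₀ = binom n k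
    x₁ = binom n (suc k)
    split : ∀ n k x₀ x₁ → ((1ℤ + n) - (1ℤ + k)) * (x₀ + x₁) ≡ (n - k) * x₀ + ((1ℤ + n) - (1ℤ + k)) * x₁
    split = solve-∀
    collect : ∀ n k x → (1ℤ + k) * x + ((1ℤ + n) - (1ℤ + k)) * x ≡ (1ℤ + n) * x
    collect = solve-∀

  central : ℕ → ℤ
  central n = binom (2 ℕ.* n) n

  catalan : ℕ → ℤ
  catalan n = central n - binom (2 ℕ.* n) (suc n)

  [n+1]*catalan≡central : ∀ n → + suc n * catalan n ≡ central n
  [n+1]*catalan≡central n = begin
    + suc n * (C₀ - C₁)                  ≡⟨ expand (+ n) C₀ C₁ ⟩
    + suc n * C₀ - + suc n * C₁          ≡⟨ cong (+ suc n * C₀ -_) ([k+1]*nC[k+1]≡[n-k]*nCk (2 ℕ.* n) n) ⟩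
    + suc n * C₀ - (+ (2 ℕ.* n) - + n) * C₀  ≡⟨ cong (λ t → + suc n * C₀ - (t - + n) * C₀) (pos-* 2 n) ⟩
    + suc n * C₀ - (+ 2 * + n - + n) * C₀    ≡⟨ cancel (+ n) C₀ ⟩
    C₀                                   ∎
    where
    C₀ = central n
    C₁ = binom (2 ℕ.* n) (suc n)
    expand : ∀ n x y → (1ℤ + n) * (x - y) ≡ (1ℤ + n) * x - (1ℤ + n) * y
    expand = solve-∀
    cancel : ∀ n x → (1ℤ + n) * x - (+ 2 * n - n) * x ≡ x
    cancel = solve-∀

  [n+1]*central[n+1]≡2[2n+1]*central : ∀ n → + suc n * central (suc n) ≡ + 2 * (+ 2 * + n + 1ℤ) * central n
  [n+1]*central[n+1]≡2[2n+1]*central n = begin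
    + suc n * central (suc n)
      ≡⟨ cong (λ m → + suc n * binom m (suc n)) 2[n+1]≡2n+2 ⟩
    + suc n * binom (suc (suc (2 ℕ.* n))) (suc n)
      ≡⟨ [k+1]*[n+1]C[k+1]≡[n+1]*nCk (suc (2 ℕ.* n)) n ⟩
    (1ℤ + (1ℤ + + (2 ℕ.* n))) * X
      ≡⟨ cong (λ t → (1ℤ + (1ℤ + t)) * X) (pos-* 2 n) ⟩
    (1ℤ + (1ℤ + + 2 * + n)) * X
      ≡⟨ double (+ n) X ⟩
    + 2 * ((1ℤ + + 2 * + n - + n) * X)
      ≡⟨ cong (λ t → + 2 * ((1ℤ + t - + n) * X)) (pos-* 2 n) ⟨
    + 2 * ((+ suc (2 ℕ.* n) - + n) * X)
      ≡⟨ cong (+ 2 *_) ([n+1-k]*[n+1]Ck≡[n+1]*nCk (2 ℕ.* n) n) ⟩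
    + 2 * ((1ℤ + + (2 ℕ.* n)) * central n)
      ≡⟨ cong (λ t → + 2 * ((1ℤ + t) * central n)) (pos-* 2 n) ⟩
    + 2 * ((1ℤ + + 2 * + n) * central n)
      ≡⟨ reassociate (+ n) (central n) ⟩
    + 2 * (+ 2 * + n + 1ℤ) * central n ∎
    where
    X = binom (suc (2 ℕ.* n)) n
    2[n+1]≡2n+2 : 2 ℕ.* suc n ≡ suc (suc (2 ℕ.* n))
    2[n+1]≡2n+2 = cong suc (+-suc n (n ℕ.+ 0))
    double : ∀ n x → (1ℤ + (1ℤ + + 2 * n)) * x ≡ + 2 * ((1ℤ + + 2 * n - n) * x)
    double = solve-∀
    reassociate : ∀ n x → + 2 * ((1ℤ + + 2 * n) * x) ≡ + 2 * (+ 2 * n + 1ℤ) * x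
    reassociate = solve-∀

module Sums where
  open import Data.Integer using (+_; _+_; _-_; _*_; 0ℤ)
  open import Data.Integer.Properties using (pos-+; +-identityʳ)
  open import Data.Integer.Tactic.RingSolver using (solve-∀)

  sumBelowℤ : ℕ → (ℕ → ℤ) → ℤ
  sumBelowℤ zero    f = 0ℤ
  sumBelowℤ (suc m) f = sumBelowℤ m f + f m

  +-sumBelow : ∀ m (f : ℕ → ℕ) → + sumBelow m f ≡ sumBelowℤ m (λ j → + f j)
  +-sumBelow zero    f = refl
  +-sumBelow (suc m) f = trans (pos-+ (sumBelow m f) (f m)) (cong (_+ + f m) (+-sumBelow m f))

  sumBelowℤ-cong : ∀ m {f h : ℕ → ℤ} → (∀ j → f j ≡ h j) → sumBelowℤ m f ≡ sumBelowℤ m h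
  sumBelowℤ-cong zero    f≡h = refl
  sumBelowℤ-cong (suc m) f≡h = cong₂ _+_ (sumBelowℤ-cong m f≡h) (f≡h m)

  sumBelowℤ-extend : ∀ m {f : ℕ → ℤ} → f m ≡ 0ℤ → sumBelowℤ (suc m) f ≡ sumBelowℤ m f
  sumBelowℤ-extend m {f} fm≡0 = trans (cong (λ t → sumBelowℤ m f + t) fm≡0) (+-identityʳ _)

  sumBelowℤ-+ : ∀ m (f h : ℕ → ℤ) → sumBelowℤ m (λ j → f j + h j) ≡ sumBelowℤ m f + sumBelowℤ m h
  sumBelowℤ-+ zero    f h = refl
  sumBelowℤ-+ (suc m) f h =
    trans (cong (_+ (f m + h m)) (sumBelowℤ-+ m f h)) (interchange (sumBelowℤ m f) (sumBelowℤ m h) (f m) (h m))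
    where
    interchange : ∀ a b c d → (a + b) + (c + d) ≡ (a + c) + (b + d)
    interchange = solve-∀

  sumBelowℤ-* : ∀ m k (f : ℕ → ℤ) → sumBelowℤ m (λ j → k * f j) ≡ k * sumBelowℤ m f
  sumBelowℤ-* zero    k f = zeroʳ k
    where
    zeroʳ : ∀ k → 0ℤ ≡ k * 0ℤ
    zeroʳ = solve-∀
  sumBelowℤ-* (suc m) k f =
    trans (cong (_+ k * f m) (sumBelowℤ-* m k f)) (distribˡ k (sumBelowℤ m f) (f m))
    where
    distribˡ : ∀ k a b → k * a + k * b ≡ k * (a + b)
    distribˡ = solve-∀

  sumBelowℤ-telescope : ∀ m (f : ℕ → ℤ) → sumBelowℤ m (λ j → f (suc j) - f j) ≡ f m - f 0
  sumBelowℤ-telescope zero    f = cancel (f 0)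
    where
    cancel : ∀ a → 0ℤ ≡ a - a
    cancel = solve-∀
  sumBelowℤ-telescope (suc m) f =
    trans (cong (_+ (f (suc m) - f m)) (sumBelowℤ-telescope m f)) (chain (f m) (f 0) (f (suc m)))
    where
    chain : ∀ a b c → (a - b) + (c - a) ≡ c - b
    chain = solve-∀

module Newton where
  open import Data.Integer using (+_; -_; _+_; _-_; _*_; 0ℤ; 1ℤ)
  open import Data.Integer.Properties using (pos-+; pos-*; +-identityˡ; +-identityʳ; *-zeroʳ)
  open import Data.Integer.Tactic.RingSolver using (solve-∀)

  -- x ∷ p is the function with value x at 0 whose forward difference is p,
  -- so ⟦ p ⟧ j = Σᵢ pᵢ C(j, i).
  ⟦_⟧ : List ℤ → ℕ → ℤ
  ⟦ []    ⟧ j       = 0ℤ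
  ⟦ x ∷ p ⟧ zero    = x
  ⟦ x ∷ p ⟧ (suc j) = ⟦ x ∷ p ⟧ j + ⟦ p ⟧ j

  infixl 6 _⊕_

  _⊕_ : List ℤ → List ℤ → List ℤ
  []      ⊕ q       = q
  (x ∷ p) ⊕ []      = x ∷ p
  (x ∷ p) ⊕ (y ∷ q) = x + y ∷ p ⊕ q

  ⟦⊕⟧ : ∀ p q j → ⟦ p ⊕ q ⟧ j ≡ ⟦ p ⟧ j + ⟦ q ⟧ j
  ⟦⊕⟧ []      q       j       = sym (+-identityˡ _)
  ⟦⊕⟧ (x ∷ p) []      j       = sym (+-identityʳ _)
  ⟦⊕⟧ (x ∷ p) (y ∷ q) zero    = refl
  ⟦⊕⟧ (x ∷ p) (y ∷ q) (suc j) = begin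
    ⟦ x + y ∷ p ⊕ q ⟧ j + ⟦ p ⊕ q ⟧ j
      ≡⟨ cong₂ _+_ (⟦⊕⟧ (x ∷ p) (y ∷ q) j) (⟦⊕⟧ p q j) ⟩
    (⟦ x ∷ p ⟧ j + ⟦ y ∷ q ⟧ j) + (⟦ p ⟧ j + ⟦ q ⟧ j)
      ≡⟨ interchange (⟦ x ∷ p ⟧ j) (⟦ y ∷ q ⟧ j) (⟦ p ⟧ j) (⟦ q ⟧ j) ⟩
    (⟦ x ∷ p ⟧ j + ⟦ p ⟧ j) + (⟦ y ∷ q ⟧ j + ⟦ q ⟧ j) ∎
    where
    interchange : ∀ a b c d → (a + b) + (c + d) ≡ (a + c) + (b + d)
    interchange = solve-∀

  ⟦map⟧ : (f : ℤ → ℤ) → f 0ℤ ≡ 0ℤ → (∀ x y → f (x + y) ≡ f x + f y) →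
          ∀ p j → ⟦ map f p ⟧ j ≡ f (⟦ p ⟧ j)
  ⟦map⟧ f f0≡0 f-+ []      j       = sym f0≡0
  ⟦map⟧ f f0≡0 f-+ (x ∷ p) zero    = refl
  ⟦map⟧ f f0≡0 f-+ (x ∷ p) (suc j) =
    trans (cong₂ _+_ (⟦map⟧ f f0≡0 f-+ (x ∷ p) j) (⟦map⟧ f f0≡0 f-+ p j)) (sym (f-+ _ _))

  ⟦scale⟧ : ∀ k p j → ⟦ map (k *_) p ⟧ j ≡ k * ⟦ p ⟧ j
  ⟦scale⟧ k = ⟦map⟧ (k *_) (zeroʳ k) (distribˡ k)
    where
    zeroʳ : ∀ k → k * 0ℤ ≡ 0ℤ
    zeroʳ = solve-∀
    distribˡ : ∀ k x y → k * (x + y) ≡ k * x + k * y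
    distribˡ = solve-∀

  infixl 6 _⊖_

  _⊖_ : List ℤ → List ℤ → List ℤ
  p ⊖ q = p ⊕ map (- 1ℤ *_) q

  ⟦⊖⟧ : ∀ p q j → ⟦ p ⊖ q ⟧ j ≡ ⟦ p ⟧ j - ⟦ q ⟧ j
  ⟦⊖⟧ p q j = begin
    ⟦ p ⊕ map (- 1ℤ *_) q ⟧ j          ≡⟨ ⟦⊕⟧ p (map (- 1ℤ *_) q) j ⟩
    ⟦ p ⟧ j + ⟦ map (- 1ℤ *_) q ⟧ j    ≡⟨ cong (λ t → ⟦ p ⟧ j + t) (⟦scale⟧ (- 1ℤ) q j) ⟩
    ⟦ p ⟧ j + - 1ℤ * ⟦ q ⟧ j           ≡⟨ minus (⟦ p ⟧ j) (⟦ q ⟧ j) ⟩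
    ⟦ p ⟧ j - ⟦ q ⟧ j                  ∎
    where
    minus : ∀ a b → a + - 1ℤ * b ≡ a - b
    minus = solve-∀

  ⟦const⟧ : ∀ x j → ⟦ x ∷ [] ⟧ j ≡ x
  ⟦const⟧ x zero    = refl
  ⟦const⟧ x (suc j) = trans (+-identityʳ _) (⟦const⟧ x j)

  shift : List ℤ → List ℤ
  shift p = p ⊕ drop 1 p

  ⟦shift⟧ : ∀ p j → ⟦ shift p ⟧ j ≡ ⟦ p ⟧ (suc j)
  ⟦shift⟧ []      j = refl
  ⟦shift⟧ (x ∷ p) j = ⟦⊕⟧ (x ∷ p) p j

  -- Δ(j f(j)) = f(j) + Δf(j) + j Δf(j)
  timesJ : List ℤ → List ℤ
  timesJ []      = []
  timesJ (x ∷ p) = 0ℤ ∷ (x ∷ p) ⊕ (p ⊕ timesJ p)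

  ⟦timesJ⟧ : ∀ p j → ⟦ timesJ p ⟧ j ≡ + j * ⟦ p ⟧ j
  ⟦timesJ⟧ []      j       = sym (*-zeroʳ (+ j))
  ⟦timesJ⟧ (x ∷ p) zero    = refl
  ⟦timesJ⟧ (x ∷ p) (suc j) = begin
    ⟦ timesJ (x ∷ p) ⟧ j + ⟦ (x ∷ p) ⊕ (p ⊕ timesJ p) ⟧ j
      ≡⟨ cong₂ _+_ (⟦timesJ⟧ (x ∷ p) j) (trans (⟦⊕⟧ (x ∷ p) (p ⊕ timesJ p) j)
                                               (cong (λ t → ⟦ x ∷ p ⟧ j + t) (⟦⊕⟧ p (timesJ p) j))) ⟩
    + j * ⟦ x ∷ p ⟧ j + (⟦ x ∷ p ⟧ j + (⟦ p ⟧ j + ⟦ timesJ p ⟧ j))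
      ≡⟨ cong (λ t → + j * ⟦ x ∷ p ⟧ j + (⟦ x ∷ p ⟧ j + (⟦ p ⟧ j + t))) (⟦timesJ⟧ p j) ⟩
    + j * ⟦ x ∷ p ⟧ j + (⟦ x ∷ p ⟧ j + (⟦ p ⟧ j + + j * ⟦ p ⟧ j))
      ≡⟨ collect (+ j) (⟦ x ∷ p ⟧ j) (⟦ p ⟧ j) ⟩
    + suc j * (⟦ x ∷ p ⟧ j + ⟦ p ⟧ j) ∎
    where
    collect : ∀ j a d → j * a + (a + (d + j * d)) ≡ (1ℤ + j) * (a + d)
    collect = solve-∀

  oddPowerSeries : ℕ → List ℤ
  oddPowerSeries zero    = 1ℤ ∷ []
  oddPowerSeries (suc s) = map (+ 2 *_) (timesJ (oddPowerSeries s)) ⊕ oddPowerSeries s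

  ⟦oddPowerSeries⟧ : ∀ s j → ⟦ oddPowerSeries s ⟧ j ≡ + ((2 ℕ.* j ℕ.+ 1) ℕ.^ s)
  ⟦oddPowerSeries⟧ zero    j = ⟦const⟧ 1ℤ j
  ⟦oddPowerSeries⟧ (suc s) j = begin
    ⟦ map (+ 2 *_) (timesJ (oddPowerSeries s)) ⊕ oddPowerSeries s ⟧ j
      ≡⟨ ⟦⊕⟧ (map (+ 2 *_) (timesJ (oddPowerSeries s))) (oddPowerSeries s) j ⟩
    ⟦ map (+ 2 *_) (timesJ (oddPowerSeries s)) ⟧ j + ⟦ oddPowerSeries s ⟧ j
      ≡⟨ cong (_+ ⟦ oddPowerSeries s ⟧ j) (trans (⟦scale⟧ (+ 2) (timesJ (oddPowerSeries s)) j)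
                                          (cong (+ 2 *_) (⟦timesJ⟧ (oddPowerSeries s) j))) ⟩
    + 2 * (+ j * w) + w
      ≡⟨ factor (+ j) w ⟩
    (+ 2 * + j + 1ℤ) * w
      ≡⟨ cong₂ _*_ (sym (trans (pos-+ (2 ℕ.* j) 1) (cong (_+ 1ℤ) (pos-* 2 j)))) (⟦oddPowerSeries⟧ s j) ⟩
    + (2 ℕ.* j ℕ.+ 1) * + ((2 ℕ.* j ℕ.+ 1) ℕ.^ s)
      ≡⟨ pos-* (2 ℕ.* j ℕ.+ 1) _ ⟨
    + ((2 ℕ.* j ℕ.+ 1) ℕ.^ suc s) ∎
    where
    w = ⟦ oddPowerSeries s ⟧ j
    factor : ∀ j w → + 2 * (j * w) + w ≡ (+ 2 * j + 1ℤ) * w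
    factor = solve-∀

  ⟦zeros⟧ : ∀ {p} → All (_≡ 0ℤ) p → ∀ j → ⟦ p ⟧ j ≡ 0ℤ
  ⟦zeros⟧ []                 j       = refl
  ⟦zeros⟧ (x≡0 ∷ p≡0)        zero    = x≡0
  ⟦zeros⟧ {x ∷ p} (x≡0 ∷ p≡0) (suc j) = cong₂ _+_ (⟦zeros⟧ (x≡0 ∷ p≡0) j) (⟦zeros⟧ p≡0 j)

module RecurrenceCertificate where
  open import Data.Integer using (+_; _+_; _-_; _*_; 0ℤ; 1ℤ)
  open import Data.Integer.Properties using (i-j≡0⇒i≡j)
  open import Data.Integer.Tactic.RingSolver using (solve-∀)
  open Newton

  oddPow : ℕ → ℕ → ℤ
  oddPow s j = + ((2 ℕ.* j ℕ.+ 1) ℕ.^ s)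

  Recurrence : ℕ → ℕ → (ℕ → ℤ) → Set
  Recurrence s c B = ∀ j → + suc j * B (suc j) ≡ + j * B j + + c * (1ℤ - + j) * oddPow s j

  leftSeries : List ℤ → List ℤ
  leftSeries e = timesJ (shift e) ⊕ shift e

  ⟦leftSeries⟧ : ∀ e j → ⟦ leftSeries e ⟧ j ≡ + suc j * ⟦ e ⟧ (suc j)
  ⟦leftSeries⟧ e j = begin
    ⟦ timesJ (shift e) ⊕ shift e ⟧ j           ≡⟨ ⟦⊕⟧ (timesJ (shift e)) (shift e) j ⟩
    ⟦ timesJ (shift e) ⟧ j + ⟦ shift e ⟧ j     ≡⟨ cong (_+ ⟦ shift e ⟧ j) (⟦timesJ⟧ (shift e) j) ⟩
    + j * ⟦ shift e ⟧ j + ⟦ shift e ⟧ j        ≡⟨ cong (λ t → + j * t + t) (⟦shift⟧ e j) ⟩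
    + j * ⟦ e ⟧ (suc j) + ⟦ e ⟧ (suc j)        ≡⟨ collect (+ j) (⟦ e ⟧ (suc j)) ⟩
    + suc j * ⟦ e ⟧ (suc j)                    ∎
    where
    collect : ∀ j x → j * x + x ≡ (1ℤ + j) * x
    collect = solve-∀

  rightSeries : ℕ → ℕ → List ℤ → List ℤ
  rightSeries s c e = timesJ e ⊕ map (+ c *_) (W ⊖ timesJ W)
    where
    W = oddPowerSeries s

  ⟦rightSeries⟧ : ∀ s c e j → ⟦ rightSeries s c e ⟧ j ≡ + j * ⟦ e ⟧ j + + c * (1ℤ - + j) * oddPow s j
  ⟦rightSeries⟧ s c e j = begin
    ⟦ timesJ e ⊕ map (+ c *_) (W ⊖ timesJ W) ⟧ j
      ≡⟨ ⟦⊕⟧ (timesJ e) (map (+ c *_) (W ⊖ timesJ W)) j ⟩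
    ⟦ timesJ e ⟧ j + ⟦ map (+ c *_) (W ⊖ timesJ W) ⟧ j
      ≡⟨ cong₂ _+_ (⟦timesJ⟧ e j) (trans (⟦scale⟧ (+ c) (W ⊖ timesJ W) j) (cong (+ c *_) (⟦⊖⟧ W (timesJ W) j))) ⟩
    + j * ⟦ e ⟧ j + + c * (⟦ W ⟧ j - ⟦ timesJ W ⟧ j)
      ≡⟨ cong (λ t → + j * ⟦ e ⟧ j + + c * (⟦ W ⟧ j - t)) (⟦timesJ⟧ W j) ⟩
    + j * ⟦ e ⟧ j + + c * (⟦ W ⟧ j - + j * ⟦ W ⟧ j)
      ≡⟨ cong (λ w → + j * ⟦ e ⟧ j + + c * (w - + j * w)) (⟦oddPowerSeries⟧ s j) ⟩
    + j * ⟦ e ⟧ j + + c * (oddPow s j - + j * oddPow s j)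
      ≡⟨ factor (+ j) (+ c) (⟦ e ⟧ j) (oddPow s j) ⟩
    + j * ⟦ e ⟧ j + + c * (1ℤ - + j) * oddPow s j ∎
    where
    W = oddPowerSeries s
    factor : ∀ j c x w → j * x + c * (w - j * w) ≡ j * x + c * (1ℤ - j) * w
    factor = solve-∀

  recurrenceDefect : ℕ → ℕ → List ℤ → List ℤ
  recurrenceDefect s c e = leftSeries e ⊖ rightSeries s c e

  recurrence-from-defect : ∀ s c e → All (_≡ 0ℤ) (recurrenceDefect s c e) → Recurrence s c ⟦ e ⟧
  recurrence-from-defect s c e defect≡0 j = i-j≡0⇒i≡j _ _ (begin
    + suc j * ⟦ e ⟧ (suc j) - (+ j * ⟦ e ⟧ j + + c * (1ℤ - + j) * oddPow s j)
      ≡⟨ cong₂ _-_ (⟦leftSeries⟧ e j) (⟦rightSeries⟧ s c e j) ⟨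
    ⟦ leftSeries e ⟧ j - ⟦ rightSeries s c e ⟧ j
      ≡⟨ ⟦⊖⟧ (leftSeries e) (rightSeries s c e) j ⟨
    ⟦ recurrenceDefect s c e ⟧ j
      ≡⟨ ⟦zeros⟧ defect≡0 j ⟩
    0ℤ ∎)

open RecurrenceCertificate using (oddPow; Recurrence; recurrenceDefect; recurrence-from-defect)

module BinomialQuadraticSum (α β : ℕ → ℤ) where
  open import Data.Integer using (+_; -_; _+_; _-_; _*_; 0ℤ; 1ℤ)
  open import Data.Integer.Properties using (+-identityʳ)
  open import Data.Integer.Tactic.RingSolver using (solve-∀)
  open Binomial
  open Sums

  g : ℕ → ℕ → ℤ
  g n j = (+ n - + j) * binom n j * ((+ n - + j) * binom n j * α j + + j * binom n j * β j)

  G : ℕ → ℤ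
  G n = sumBelowℤ (suc n) (g n)

  E : ℕ → ℕ → ℤ
  E n j = + suc j * (+ 2 * + n + 1ℤ - + j) * α j + + j * (+ 2 * + j + 1ℤ) * β j
        + + suc j * (+ n - + j) * β (suc j)

  ψ : ℕ → ℕ → ℤ
  ψ n zero    = 0ℤ
  ψ n (suc i) = - (+ suc i * (+ n - + i) * (binom n i * binom n i) * β (suc i))

  g-suc : ∀ n j → g (suc n) j ≡ g n j + binom n j * binom n j * E n j + (ψ n (suc j) - ψ n j)
  g-suc n zero    = identity (+ n) (α 0) (β 0) (β 1)
    where
    identity : ∀ n a b b′ →
      ((1ℤ + n) - + 0) * + 1 * (((1ℤ + n) - + 0) * + 1 * a + + 0 * + 1 * b)
      ≡ (n - + 0) * + 1 * ((n - + 0) * + 1 * a + + 0 * + 1 * b)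
        + + 1 * + 1 * (+ 1 * (+ 2 * n + 1ℤ - + 0) * a + + 0 * (+ 2 * + 0 + 1ℤ) * b + + 1 * (n - + 0) * b′)
        + (- (+ 1 * (n - + 0) * (+ 1 * + 1) * b′) - 0ℤ)
    identity = solve-∀
  g-suc n (suc i) = begin
    g (suc n) (suc i)
      ≡⟨ cong₂ (λ p q → p * (p * α (suc i) + + suc i * q * β (suc i)))
               ([n+1-k]*[n+1]Ck≡[n+1]*nCk n (suc i)) (sym (nCk+nC[k+1]≡[n+1]C[k+1] n i)) ⟩
    + suc n * x * (+ suc n * x * α (suc i) + + suc i * (y + x) * β (suc i))
      ≡⟨ identity (+ n) (+ i) x y (α (suc i)) (β (suc i)) (β (suc (suc i))) ⟩
    rhs + + suc i * (y - x) * β (suc i) * (+ suc i * x - (+ n - + i) * y)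
      ≡⟨ cong (λ t → rhs + + suc i * (y - x) * β (suc i) * (t - (+ n - + i) * y))
              ([k+1]*nC[k+1]≡[n-k]*nCk n i) ⟩
    rhs + + suc i * (y - x) * β (suc i) * ((+ n - + i) * y - (+ n - + i) * y)
      ≡⟨ cancel rhs (+ suc i * (y - x) * β (suc i)) ((+ n - + i) * y) ⟩
    rhs ∎
    where
    x = binom n (suc i)
    y = binom n i
    rhs = g n (suc i) + x * x * E n (suc i) + (ψ n (suc (suc i)) - ψ n (suc i))
    -- The sides differ by a multiple of (i + 1) C(n, i + 1) − (n − i) C(n, i), which is 0.
    identity : ∀ n i x y a b b′ →
      (1ℤ + n) * x * ((1ℤ + n) * x * a + (1ℤ + i) * (y + x) * b)
      ≡ (n - (1ℤ + i)) * x * ((n - (1ℤ + i)) * x * a + (1ℤ + i) * x * b)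
        + x * x * ((1ℤ + (1ℤ + i)) * (+ 2 * n + 1ℤ - (1ℤ + i)) * a
                   + (1ℤ + i) * (+ 2 * (1ℤ + i) + 1ℤ) * b + (1ℤ + (1ℤ + i)) * (n - (1ℤ + i)) * b′)
        + (- ((1ℤ + (1ℤ + i)) * (n - (1ℤ + i)) * (x * x) * b′) - - ((1ℤ + i) * (n - i) * (y * y) * b))
        + (1ℤ + i) * (y - x) * b * ((1ℤ + i) * x - (n - i) * y)
    identity = solve-∀
    cancel : ∀ a k t → a + k * (t - t) ≡ a
    cancel = solve-∀

  g[n,n+1]≡0 : ∀ n → g n (suc n) ≡ 0ℤ
  g[n,n+1]≡0 n = trans (cong (λ z → p * z * (p * z * α (suc n) + + suc n * z * β (suc n))) (nC[n+1]≡0 n))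
                       (annihilate p (α (suc n)) (+ suc n) (β (suc n)))
    where
    p = + n - + suc n
    annihilate : ∀ p a q b → p * 0ℤ * (p * 0ℤ * a + q * 0ℤ * b) ≡ 0ℤ
    annihilate = solve-∀

  ψ[n,n+2]≡0 : ∀ n → ψ n (suc (suc n)) ≡ 0ℤ
  ψ[n,n+2]≡0 n = trans (cong (λ z → - (+ suc (suc n) * (+ n - + suc n) * (z * z) * β (suc (suc n)))) (nC[n+1]≡0 n))
                       (annihilate (+ suc (suc n) * (+ n - + suc n)) (β (suc (suc n))))
    where
    annihilate : ∀ p b → - (p * (0ℤ * 0ℤ) * b) ≡ 0ℤ
    annihilate = solve-∀

  G-suc : ∀ n → G (suc n) ≡ G n + sumBelowℤ (suc n) (λ j → binom n j * binom n j * E n j)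
  G-suc n = begin
    sumBelowℤ (2+n) (g (suc n))
      ≡⟨ sumBelowℤ-cong (2+n) (g-suc n) ⟩
    sumBelowℤ (2+n) (λ j → g n j + e j + (ψ n (suc j) - ψ n j))
      ≡⟨ sumBelowℤ-+ (2+n) (λ j → g n j + e j) (λ j → ψ n (suc j) - ψ n j) ⟩
    sumBelowℤ (2+n) (λ j → g n j + e j) + sumBelowℤ (2+n) (λ j → ψ n (suc j) - ψ n j)
      ≡⟨ cong₂ _+_ (sumBelowℤ-+ (2+n) (g n) e) (sumBelowℤ-telescope (2+n) (ψ n)) ⟩
    sumBelowℤ (2+n) (g n) + sumBelowℤ (2+n) e + (ψ n (2+n) - 0ℤ)
      ≡⟨ cong₂ _+_ (cong₂ _+_ (sumBelowℤ-extend (suc n) (g[n,n+1]≡0 n))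
                              (sumBelowℤ-extend (suc n) (cong (λ z → z * z * E n (suc n)) (nC[n+1]≡0 n))))
                   (cong (_- 0ℤ) (ψ[n,n+2]≡0 n)) ⟩
    G n + sumBelowℤ (suc n) e + (0ℤ - 0ℤ)
      ≡⟨ +-identityʳ _ ⟩
    G n + sumBelowℤ (suc n) e ∎
    where
    2+n = suc (suc n)
    e : ℕ → ℤ
    e j = binom n j * binom n j * E n j

  h : ℕ → ℕ → ℤ
  h m zero    = α 0
  h m (suc i) = binom m (suc i) * (binom m (suc i) * α (suc i) + binom m i * β (suc i))

  g-suc≡[m+1]²*h : ∀ m j → g (suc m) j ≡ + suc m * + suc m * h m j
  g-suc≡[m+1]²*h m zero    = identity (+ m) (α 0) (β 0)
    where
    identity : ∀ m a b → ((1ℤ + m) - + 0) * + 1 * (((1ℤ + m) - + 0) * + 1 * a + + 0 * + 1 * b)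
                         ≡ (1ℤ + m) * (1ℤ + m) * a
    identity = solve-∀
  g-suc≡[m+1]²*h m (suc i) = begin
    g (suc m) (suc i)
      ≡⟨ cong₂ (λ p q → p * (p * α (suc i) + q * β (suc i)))
               ([n+1-k]*[n+1]Ck≡[n+1]*nCk m (suc i)) ([k+1]*[n+1]C[k+1]≡[n+1]*nCk m i) ⟩
    + suc m * x * (+ suc m * x * α (suc i) + + suc m * y * β (suc i))
      ≡⟨ factor (+ suc m) x y (α (suc i)) (β (suc i)) ⟩
    + suc m * + suc m * h m (suc i) ∎
    where
    x = binom m (suc i)
    y = binom m i
    factor : ∀ s x y a b → s * x * (s * x * a + s * y * b) ≡ s * s * (x * (x * a + y * b))
    factor = solve-∀

  G-suc≡[m+1]²*H : ∀ m → G (suc m) ≡ + suc m * + suc m * sumBelowℤ (suc (suc m)) (h m)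
  G-suc≡[m+1]²*H m = trans (sumBelowℤ-cong (suc (suc m)) (g-suc≡[m+1]²*h m))
                           (sumBelowℤ-* (suc (suc m)) (+ suc m * + suc m) (h m))

module WeightedSum (s c : ℕ) (B : ℕ → ℤ) (recurrence : Recurrence s c B) where
  open import Data.Integer using (+_; _+_; _-_; _*_; 0ℤ; 1ℤ; ∣_∣)
  open import Data.Integer.Properties using (pos-+; pos-*; abs-*)
  open import Data.Integer.Tactic.RingSolver using (solve-∀)
  import Data.Nat.Tactic.RingSolver as ℕ-Solver
  open import Data.Nat.Divisibility using (_∣_; _∣0; m∣m*n)
  import Data.Nat.Properties as ℕₚ
  open Binomial
  open Sums

  odd : ℕ → ℤ
  odd j = + 2 * + j + 1ℤ

  α : ℕ → ℤ
  α j = catalan j * odd j * (+ c * oddPow s j - B (suc j))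

  β : ℕ → ℤ
  β j = central j * B j

  open BinomialQuadraticSum α β

  a : ℕ → ℤ
  a j = + (((2 ℕ.* j) C j) ℕ.* (2 ℕ.* j ℕ.+ 1) ℕ.^ suc s)

  a≡central*odd*oddPow : ∀ j → a j ≡ central j * (odd j * oddPow s j)
  a≡central*odd*oddPow j = begin
    + (((2 ℕ.* j) C j) ℕ.* ((2 ℕ.* j ℕ.+ 1) ℕ.* (2 ℕ.* j ℕ.+ 1) ℕ.^ s))
      ≡⟨ pos-* ((2 ℕ.* j) C j) _ ⟩
    central j * + ((2 ℕ.* j ℕ.+ 1) ℕ.* (2 ℕ.* j ℕ.+ 1) ℕ.^ s)
      ≡⟨ cong (central j *_) (pos-* (2 ℕ.* j ℕ.+ 1) _) ⟩
    central j * (+ (2 ℕ.* j ℕ.+ 1) * oddPow s j)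
      ≡⟨ cong (λ t → central j * (t * oddPow s j)) (trans (pos-+ (2 ℕ.* j) 1) (cong (_+ 1ℤ) (pos-* 2 j))) ⟩
    central j * (odd j * oddPow s j) ∎

  E≡central*odd*bracket : ∀ n j → E n j ≡ central j * odd j *
    ((+ 2 * + n + 1ℤ - + j) * (+ c * oddPow s j - B (suc j)) + + j * B j + + 2 * (+ n - + j) * B (suc j))
  E≡central*odd*bracket n j = begin
    E n j
      ≡⟨ regroup (+ n) (+ j) (+ c) (catalan j) (central j) (central (suc j)) w (B j) (B (suc j)) ⟩
    (+ suc j * catalan j) * odd j * ((+ 2 * + n + 1ℤ - + j) * (+ c * w - B (suc j)))
      + central j * odd j * (+ j * B j) + (+ suc j * central (suc j)) * ((+ n - + j) * B (suc j))
      ≡⟨ cong₂ (λ u v → u * odd j * ((+ 2 * + n + 1ℤ - + j) * (+ c * w - B (suc j)))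
                         + central j * odd j * (+ j * B j) + v * ((+ n - + j) * B (suc j)))
               ([n+1]*catalan≡central j) ([n+1]*central[n+1]≡2[2n+1]*central j) ⟩
    central j * odd j * ((+ 2 * + n + 1ℤ - + j) * (+ c * w - B (suc j)))
      + central j * odd j * (+ j * B j) + + 2 * odd j * central j * ((+ n - + j) * B (suc j))
      ≡⟨ collect (+ n) (+ j) (+ c) (central j) w (B j) (B (suc j)) ⟩
    central j * odd j * ((+ 2 * + n + 1ℤ - + j) * (+ c * w - B (suc j)) + + j * B j + + 2 * (+ n - + j) * B (suc j)) ∎
    where
    w = oddPow s j
    regroup : ∀ n j c Ca C C′ w b b′ →
      (1ℤ + j) * (+ 2 * n + 1ℤ - j) * (Ca * (+ 2 * j + 1ℤ) * (c * w - b′)) + j * (+ 2 * j + 1ℤ) * (C * b)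
        + (1ℤ + j) * (n - j) * (C′ * b′)
      ≡ ((1ℤ + j) * Ca) * (+ 2 * j + 1ℤ) * ((+ 2 * n + 1ℤ - j) * (c * w - b′))
        + C * (+ 2 * j + 1ℤ) * (j * b) + ((1ℤ + j) * C′) * ((n - j) * b′)
    regroup = solve-∀
    collect : ∀ n j c C w b b′ →
      C * (+ 2 * j + 1ℤ) * ((+ 2 * n + 1ℤ - j) * (c * w - b′)) + C * (+ 2 * j + 1ℤ) * (j * b)
        + + 2 * (+ 2 * j + 1ℤ) * C * ((n - j) * b′)
      ≡ C * (+ 2 * j + 1ℤ) * ((+ 2 * n + 1ℤ - j) * (c * w - b′) + j * b + + 2 * (n - j) * b′)
    collect = solve-∀

  bracket≡2cn*oddPow : ∀ n j →
    (+ 2 * + n + 1ℤ - + j) * (+ c * oddPow s j - B (suc j)) + + j * B j + + 2 * (+ n - + j) * B (suc j)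
    ≡ + 2 * + c * + n * oddPow s j
  bracket≡2cn*oddPow n j = begin
    (+ 2 * + n + 1ℤ - + j) * (+ c * w - B (suc j)) + + j * B j + + 2 * (+ n - + j) * B (suc j)
      ≡⟨ isolate (+ n) (+ j) (+ c) w (B j) (B (suc j)) ⟩
    + 2 * + c * + n * w + (+ j * B j + + c * (1ℤ - + j) * w - + suc j * B (suc j))
      ≡⟨ cong (λ t → + 2 * + c * + n * w + (+ j * B j + + c * (1ℤ - + j) * w - t)) (recurrence j) ⟩
    + 2 * + c * + n * w + (+ j * B j + + c * (1ℤ - + j) * w - (+ j * B j + + c * (1ℤ - + j) * w))
      ≡⟨ cancel (+ 2 * + c * + n * w) (+ j * B j + + c * (1ℤ - + j) * w) ⟩
    + 2 * + c * + n * w ∎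
    where
    w = oddPow s j
    isolate : ∀ n j c w b b′ →
      (+ 2 * n + 1ℤ - j) * (c * w - b′) + j * b + + 2 * (n - j) * b′
      ≡ + 2 * c * n * w + (j * b + c * (1ℤ - j) * w - (1ℤ + j) * b′)
    isolate = solve-∀
    cancel : ∀ x t → x + (t - t) ≡ x
    cancel = solve-∀

  E≡2cn*a : ∀ n j → E n j ≡ + 2 * + c * + n * a j
  E≡2cn*a n j = begin
    E n j                                                ≡⟨ E≡central*odd*bracket n j ⟩
    central j * odd j * _                                ≡⟨ cong (central j * odd j *_) (bracket≡2cn*oddPow n j) ⟩
    central j * odd j * (+ 2 * + c * + n * oddPow s j)   ≡⟨ reorder (central j) (odd j) (+ 2 * + c * + n) (oddPow s j) ⟩
    + 2 * + c * + n * (central j * (odd j * oddPow s j)) ≡⟨ cong (+ 2 * + c * + n *_) (a≡central*odd*oddPow j) ⟨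
    + 2 * + c * + n * a j                                ∎
    where
    reorder : ∀ C o k w → C * o * (k * w) ≡ k * (C * (o * w))
    reorder = solve-∀

  +S≡sum : ∀ n → + S (suc s) n ≡ sumBelowℤ (suc n) (λ j → binom n j * binom n j * a j)
  +S≡sum n = trans (+-sumBelow (suc n) _) (sumBelowℤ-cong (suc n) summand)
    where
    summand : ∀ j → + ((n C j) ℕ.^ 2 ℕ.* ((2 ℕ.* j) C j) ℕ.* (2 ℕ.* j ℕ.+ 1) ℕ.^ suc s)
                    ≡ binom n j * binom n j * a j
    summand j = begin
      + ((n C j) ℕ.^ 2 ℕ.* ((2 ℕ.* j) C j) ℕ.* (2 ℕ.* j ℕ.+ 1) ℕ.^ suc s)
        ≡⟨ cong +_ (square (n C j) ((2 ℕ.* j) C j) ((2 ℕ.* j ℕ.+ 1) ℕ.^ suc s)) ⟩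
      + ((n C j) ℕ.* (n C j) ℕ.* (((2 ℕ.* j) C j) ℕ.* (2 ℕ.* j ℕ.+ 1) ℕ.^ suc s))
        ≡⟨ pos-* ((n C j) ℕ.* (n C j)) _ ⟩
      + ((n C j) ℕ.* (n C j)) * a j
        ≡⟨ cong (_* a j) (pos-* (n C j) (n C j)) ⟩
      binom n j * binom n j * a j ∎
      where
      square : ∀ x y z → x ℕ.* (x ℕ.* 1) ℕ.* y ℕ.* z ≡ x ℕ.* x ℕ.* (y ℕ.* z)
      square = ℕ-Solver.solve-∀

  F : ℕ → ℕ
  F n = sumBelow n (λ k → k ℕ.* S (suc s) k)

  ΣE≡2cnS : ∀ n → sumBelowℤ (suc n) (λ j → binom n j * binom n j * E n j) ≡ + 2 * + c * + n * + S (suc s) n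
  ΣE≡2cnS n = begin
    sumBelowℤ (suc n) (λ j → binom n j * binom n j * E n j)
      ≡⟨ sumBelowℤ-cong (suc n) (λ j → trans (cong (binom n j * binom n j *_) (E≡2cn*a n j))
                                             (pull-out (binom n j) (+ 2 * + c * + n) (a j))) ⟩
    sumBelowℤ (suc n) (λ j → + 2 * + c * + n * (binom n j * binom n j * a j))
      ≡⟨ sumBelowℤ-* (suc n) (+ 2 * + c * + n) _ ⟩
    + 2 * + c * + n * sumBelowℤ (suc n) (λ j → binom n j * binom n j * a j)
      ≡⟨ cong (+ 2 * + c * + n *_) (+S≡sum n) ⟨
    + 2 * + c * + n * + S (suc s) n ∎
    where
    pull-out : ∀ x k y → x * x * (k * y) ≡ k * (x * x * y)
    pull-out = solve-∀

  G≡2cF : ∀ n → G n ≡ + 2 * + c * + F n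
  G≡2cF zero    = identity (α 0) (β 0) (+ 2 * + c)
    where
    identity : ∀ a b k → 0ℤ + (+ 0 - + 0) * + 1 * ((+ 0 - + 0) * + 1 * a + + 0 * + 1 * b) ≡ k * + 0
    identity = solve-∀
  G≡2cF (suc n) = begin
    G (suc n)                                          ≡⟨ G-suc n ⟩
    G n + sumBelowℤ (suc n) _                          ≡⟨ cong₂ _+_ (G≡2cF n) (ΣE≡2cnS n) ⟩
    + 2 * + c * + F n + + 2 * + c * + n * + S (suc s) n  ≡⟨ distrib (+ 2 * + c) (+ F n) (+ n) (+ S (suc s) n) ⟩
    + 2 * + c * (+ F n + + n * + S (suc s) n)          ≡⟨ cong (+ 2 * + c *_) +F[n+1]≡ ⟨
    + 2 * + c * + F (suc n)                            ∎
    where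
    distrib : ∀ k f n t → k * f + k * n * t ≡ k * (f + n * t)
    distrib = solve-∀
    +F[n+1]≡ : + F (suc n) ≡ + F n + + n * + S (suc s) n
    +F[n+1]≡ = trans (pos-+ (F n) _) (cong (λ t → + F n + t) (pos-* n _))

  n²∣2cF : ∀ n → n ℕ.^ 2 ∣ 2 ℕ.* c ℕ.* F n
  n²∣2cF zero    = subst (0 ℕ.^ 2 ∣_) (sym (ℕₚ.*-zeroʳ (2 ℕ.* c))) ((0 ℕ.^ 2) ∣0)
  n²∣2cF (suc m) = subst (suc m ℕ.^ 2 ∣_) (sym 2cF≡) (m∣m*n ∣ H ∣)
    where
    H = sumBelowℤ (suc (suc m)) (h m)
    2cF≡ : 2 ℕ.* c ℕ.* F (suc m) ≡ suc m ℕ.^ 2 ℕ.* ∣ H ∣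
    2cF≡ = begin
      ∣ + (2 ℕ.* c ℕ.* F (suc m)) ∣          ≡⟨ cong ∣_∣ (trans (pos-* (2 ℕ.* c) _) (cong (_* + F (suc m)) (pos-* 2 c))) ⟩
      ∣ + 2 * + c * + F (suc m) ∣            ≡⟨ cong ∣_∣ (trans (sym (G≡2cF (suc m))) (G-suc≡[m+1]²*H m)) ⟩
      ∣ + suc m * + suc m * H ∣              ≡⟨ abs-* (+ suc m * + suc m) H ⟩
      ∣ + suc m * + suc m ∣ ℕ.* ∣ H ∣        ≡⟨ cong (ℕ._* ∣ H ∣) (abs-* (+ suc m) (+ suc m)) ⟩
      suc m ℕ.* suc m ℕ.* ∣ H ∣              ≡⟨ cong (λ t → suc m ℕ.* t ℕ.* ∣ H ∣) (ℕₚ.*-identityʳ (suc m)) ⟨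
      suc m ℕ.^ 2 ℕ.* ∣ H ∣                  ∎

open import Data.Nat using (_*_; _^_; _≤_; s≤s)
open import Data.Nat.Divisibility using (_∣_)
open import Data.Nat.Properties using (≤⇒≯; m≤m+n)
open import Data.Integer using (+_; -_; _≟_; 0ℤ)
open import Data.List.Relation.Unary.All using (all?)
open import Data.Product using (_×_; _,_)
open import Data.Empty using (⊥-elim)
open import Relation.Nullary.Decidable using (True; toWitness)
open Newton using (⟦_⟧)

record Certificate (s : ℕ) : Set where
  constructor certificate
  field
    c       : ℕ
    b≡2c    : b (suc s) ≡ 2 * c
    newton  : List ℤ
    checked : True (all? (_≟ 0ℤ) (recurrenceDefect s c newton))

-- The Newton coefficients B(0), ΔB(0), Δ²B(0), … of the polynomial B of degree s + 1 solving the
-- recurrence; the recurrence fixes B(j) only for j ≥ 1, and B(0) is the value of that polynomial.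
certificateFor : ∀ s → 1 ≤ s → s ≤ 14 → Certificate s
certificateFor 0 () _
certificateFor 1 _ _ = certificate 6 refl (+ 1 ∷ + 5 ∷ - + 8 ∷ []) _
certificateFor 2 _ _ = certificate 6 refl (- + 3 ∷ + 9 ∷ - + 12 ∷ - + 36 ∷ []) _
certificateFor 3 _ _ = certificate 30 refl (- + 7 ∷ + 37 ∷ - + 52 ∷ - + 1188 ∷ - + 1152 ∷ []) _
certificateFor 4 _ _ = certificate 30 refl
  (+ 21 ∷ + 9 ∷ - + 24 ∷ - + 6216 ∷ - + 15744 ∷ - + 9600 ∷ []) _
certificateFor 5 _ _ = certificate 42 refl
  (+ 31 ∷ + 11 ∷ - + 32 ∷ - + 43704 ∷ - + 210816 ∷ - + 305280 ∷ - + 138240 ∷ []) _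
certificateFor 6 _ _ = certificate 42 refl
  (- + 93 ∷ + 135 ∷ - + 156 ∷ - + 218580 ∷ - + 1759872 ∷ - + 4513920 ∷ - + 4665600 ∷ - + 1693440 ∷ []) _
certificateFor 7 _ _ = certificate 30 refl
  (- + 127 ∷ + 157 ∷ - + 172 ∷ - + 781068 ∷ - + 9814272 ∷ - + 39561600 ∷ - + 69907200 ∷
   - + 56582400 ∷ - + 17203200 ∷ []) _
certificateFor 8 _ _ = certificate 30 refl
  (+ 381 ∷ - + 351 ∷ + 336 ∷ - + 3906576 ∷ - + 73776384 ∷ - + 438416640 ∷ - + 1177205760 ∷
   - + 1593123840 ∷ - + 1063157760 ∷ - + 278691840 ∷ []) _
certificateFor 9 _ _ = certificate 66 refl
  (+ 2555 ∷ - + 2489 ∷ + 2456 ∷ - + 42971184 ∷ - + 1192018176 ∷ - + 10043179776 ∷ - + 38445087744 ∷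
   - + 77345565696 ∷ - + 84972109824 ∷ - + 48325165056 ∷ - + 11147673600 ∷ []) _
certificateFor 10 _ _ = certificate 66 refl
  (- + 7665 ∷ + 7731 ∷ - + 7764 ∷ - + 214835964 ∷ - + 8623448832 ∷ - + 100397264640 ∷
   - + 526600327680 ∷ - + 1477414632960 ∷ - + 2375786004480 ∷ - + 2198785720320 ∷
   - + 1090614067200 ∷ - + 224811417600 ∷ []) _
certificateFor 11 _ _ = certificate 2730 refl
  (- + 1414477 ∷ + 1417207 ∷ - + 1418572 ∷ - + 44432174268 ∷ - + 2554643244672 ∷
   - + 40370530118400 ∷ - + 282492483955200 ∷ - + 1061879990976000 ∷ - + 2344299348787200 ∷
   - + 3139228082995200 ∷ - + 2511320039424000 ∷ - + 1105152491520000 ∷ - + 206009008128000 ∷ []) _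
certificateFor 12 _ _ = certificate 2730 refl
  (+ 4243431 ∷ - + 4240701 ∷ + 4239336 ∷ - + 222172207176 ∷ - + 18171306893184 ∷
   - + 384789336055680 ∷ - + 3524413596779520 ∷ - + 17273305293511680 ∷ - + 50287947620843520 ∷
   - + 91375458218311680 ∷ - + 104818100502528000 ∷ - + 73865061236736000 ∷ - + 29223849295872000 ∷
   - + 4973646053376000 ∷ []) _
certificateFor 13 _ _ = certificate 6 refl
  (+ 57337 ∷ - + 57331 ∷ + 57328 ∷ - + 2441463576 ∷ - + 282732403584 ∷ - + 7946639140992 ∷
   - + 93941795186688 ∷ - + 588650051023872 ∷ - + 2198582586605568 ∷ - + 5206140604219392 ∷
   - + 8030397396418560 ∷ - + 8056420207165440 ∷ - + 5074324197212160 ∷ - + 1824034589245440 ∷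
   - + 285665824604160 ∷ []) _
certificateFor 14 _ _ = certificate 6 refl
  (- + 172011 ∷ + 172017 ∷ - + 172020 ∷ - + 12206859228 ∷ - + 1994996539008 ∷ - + 73894460112000 ∷
   - + 1115456413697280 ∷ - + 8806232911553280 ∷ - + 41364006768967680 ∷ - + 124156929432453120 ∷
   - + 247293808271032320 ∷ - + 331193688688558080 ∷ - + 295230920951070720 ∷
   - + 168124540130426880 ∷ - + 55383461745131520 ∷ - + 8034351316992000 ∷ []) _
certificateFor (suc (suc (suc (suc (suc (suc (suc (suc (suc (suc (suc (suc (suc (suc (suc k))))))))))))))) _ s≤14 =
  ⊥-elim (≤⇒≯ s≤14 (m≤m+n 15 k))

corollary5p2 : ∀ (r n : ℕ) → 2 ≤ r × r ≤ 15 → 1 ≤ n →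
    n ^ 2 ∣ b r * sumBelow n (λ k → k * S r k)
corollary5p2 (suc s) n (s≤s 1≤s , s≤s s≤14) _ =
  subst (λ d → n ^ 2 ∣ d * sumBelow n (λ k → k * S (suc s) k)) (sym b≡2c)
        (WeightedSum.n²∣2cF s c ⟦ newton ⟧ (recurrence-from-defect s c newton (toWitness checked)) n)
  where open Certificate (certificateFor s 1≤s s≤14)
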